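{- Let $\mathcal{S}$ be a generalized quadrangle $GQ(s,t)$ with $s,t>1$, and let $X$ be its point graph. Then every proper endomorphism of $X$ has a single $(s+1)$-clique as its image, and is therefore a colouring of $X$ (a homomorphism onto $K_{s+1}$).
   Context: A partial geometry $PG(s,t,\alpha)$ is a point-line incidence structure such that: (1) two distinct lines meet in at most one point and two distinct points lie on at most one common line; (2) each line contains $s+1$ points and each point lies on $t+1$ lines; (3) for any point $P$ and line $\ell$ not containing $P$, there are exactly $\alpha$ lines through $P$ meeting $\ell$. A generalized quadrangle $GQ(s,t)$ is a partial geometry $PG(s,t,1)$. Its point graph has the points as vertices, two distinct points adjacent iff they are collinear. An endomorphism of $X$ is a map $V(X)\to V(X)$ sending edges to edges; a proper endomorphism is an endomorphism that is not an automorphism. -}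

module Defs where

open import Data.Nat using (ℕ; suc)
open import Data.Fin using (Fin)
open import Data.Product using (Σ; _×_; ∃; ∃-syntax; _,_)
open import Relation.Nullary using (¬_)
open import Relation.Binary.PropositionalEquality using (_≡_; _≢_)
open import Function.Bundles using (_↔_)
open import Level using (0ℓ)

record IncidenceStructure : Set₁ where
  field
    nPoints nLines : ℕ
    _I_ : Fin nPoints → Fin nLines → Set

Point : IncidenceStructure → Set
Point S = Fin (IncidenceStructure.nPoints S)

Line : IncidenceStructure → Set
Line S = Fin (IncidenceStructure.nLines S)

record IsPartialGeometry (S : IncidenceStructure) (s t α : ℕ) : Set where
  open IncidenceStructure S
  field
    lines-meet-once : ∀ (ℓ m : Line S) (P Q : Point S) →
      P I ℓ → P I m → Q I ℓ → Q I m → ℓ ≢ m → P ≡ Q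
    points-join-once : ∀ (P Q : Point S) (ℓ m : Line S) →
      P I ℓ → Q I ℓ → P I m → Q I m → P ≢ Q → ℓ ≡ m
    line-size : ∀ (ℓ : Line S) → Fin (suc s) ↔ (Σ (Point S) λ P → P I ℓ)
    point-degree : ∀ (P : Point S) → Fin (suc t) ↔ (Σ (Line S) λ ℓ → P I ℓ)
    alpha-axiom : ∀ (P : Point S) (ℓ : Line S) → ¬ (P I ℓ) →
      Fin α ↔ (Σ (Line S) λ m → P I m × ∃[ Q ] (Q I m × Q I ℓ))

IsGQ : IncidenceStructure → ℕ → ℕ → Set
IsGQ S s t = IsPartialGeometry S s t 1

Adj : (S : IncidenceStructure) → Point S → Point S → Set
Adj S P Q = P ≢ Q × ∃[ ℓ ] (IncidenceStructure._I_ S P ℓ × IncidenceStructure._I_ S Q ℓ)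

IsEndomorphism : (S : IncidenceStructure) → (Point S → Point S) → Set
IsEndomorphism S f = ∀ P Q → Adj S P Q → Adj S (f P) (f Q)

record IsAutomorphism (S : IncidenceStructure) (f : Point S → Point S) : Set where
  field
    inverse : Point S → Point S
    left-inverse : ∀ P → inverse (f P) ≡ P
    right-inverse : ∀ P → f (inverse P) ≡ P
    preserves : ∀ P Q → Adj S P Q → Adj S (f P) (f Q)
    reflects : ∀ P Q → Adj S (f P) (f Q) → Adj S P Q

IsProperEndomorphism : (S : IncidenceStructure) → (Point S → Point S) → Set
IsProperEndomorphism S f = IsEndomorphism S f × ¬ IsAutomorphism S f

-- The image of f is exactly a clique of size k: an injective enumeration c
-- of k pairwise adjacent vertices whose range equals the image of f.
ImageIsClique : (S : IncidenceStructure) → (Point S → Point S) → ℕ → Set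
ImageIsClique S f k =
  Σ (Fin k → Point S) λ c →
    (∀ i j → i ≢ j → Adj S (c i) (c j)) ×
    (∀ P → ∃[ i ] f P ≡ c i) ×
    (∀ i → ∃[ P ] f P ≡ c i)

module Submission where

-- 1. An injective endomorphism of a finite graph is an automorphism (some iterate
--    inverts it), so a proper endomorphism f has twins: P ≢ Q with f P ≡ f Q.
-- 2. Twins are never collinear, so every line misses some point.  This makes
--    incidence proof-irrelevant, hence the enumerations of points on a line and of
--    lines through a point given by axiom (2) are injective.
-- 3. As a GQ has no triangles, f maps every line ℓ onto a line, its image.
-- 4. If P has a twin, all lines through P have the same image; consequently every
--    point collinear with P has a twin as well.
-- 5. Fix twins P₀, Q₀ and a line ℓ₀ through P₀ with image L.  Every line meets a
--    line through P₀ (axiom (3)), so by 4 every line has image L.  Hence f maps all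
--    points onto the s+1 points of L, which form a clique.

open import Defs
open import Data.Nat using (ℕ; suc; _<_)
open import Data.Nat.Base using (zero; _+_; _^_; s≤s)
open import Data.Nat.Properties using (n<1+n; m≤n⇒∃[o]m+o≡n; +-suc)
open import Data.Fin.Base using (Fin; toℕ; punchOut; funToFin; finToFun)
open import Data.Fin.Patterns using (0F; 1F)
open import Data.Fin.Properties
  using (_≟_; any?; pigeonhole; punchOut-injective; <⇒notInjective; finToFun-funToFin)
open import Data.Product.Base using (Σ; _×_; ∃; ∃₂; ∃-syntax; _,_; proj₁; proj₂)
open import Data.Product.Properties using (,-injectiveʳ-UIP)
open import Data.Empty using (⊥-elim)
open import Relation.Nullary using (¬_; Dec; yes; no)
open import Relation.Nullary.Decidable using (¬?; _×-dec_)
open import Relation.Binary.PropositionalEquality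
open import Function.Base using (_∘_)
open import Function.Bundles using (_↔_; Inverse; Injection)
open import Function.Definitions using (Injective)
open import Function.Construct.Symmetry using (↔-sym)
open import Function.Properties.Inverse using (↔⇒↣)
open import Axiom.UniquenessOfIdentityProofs using (UIP; module Decidable⇒UIP)

unique-from-Fin1 : {A : Set} → Fin 1 ↔ A → (x y : A) → x ≡ y
unique-from-Fin1 e x y = Injection.injective (↔⇒↣ (↔-sym e)) (Fin1-trivial _ _)
  where
  Fin1-trivial : (i j : Fin 1) → i ≡ j
  Fin1-trivial 0F 0F = refl

Fin-UIP : ∀ {n} → UIP (Fin n)
Fin-UIP = Decidable⇒UIP.≡-irrelevant _≟_

-- An injective self-map of Fin n is surjective: a missed value k would give an
-- injection Fin n → Fin (n - 1) by punching k out.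
injective⇒surjective : ∀ {n} (g : Fin n → Fin n) → Injective _≡_ _≡_ g →
  ∀ k → ∃ λ i → g i ≡ k
injective⇒surjective {suc m} g inj k with any? (λ i → g i ≟ k)
... | yes hit = hit
... | no missed = ⊥-elim (<⇒notInjective (n<1+n m) squeezed-injective)
  where
  squeezed : Fin (suc m) → Fin m
  squeezed i = punchOut {i = k} (λ eq → missed (i , sym eq))
  squeezed-injective : Injective _≡_ _≡_ squeezed
  squeezed-injective {i} {j} eq =
    inj (punchOut-injective (λ e → missed (i , sym e)) (λ e → missed (j , sym e)) eq)

-- An injection from a set of more than two elements avoids any two given values:
-- otherwise recording which of the two each value equals would be an injection
-- into Fin 2.
avoid-two : ∀ {k m} (p : Fin k → Fin m) → Injective _≡_ _≡_ p → 2 < k →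
  (X Y : Fin m) → ∃ λ i → p i ≢ X × p i ≢ Y
avoid-two {k} {m} p inj 2<k X Y with any? (λ i → ¬? (p i ≟ X) ×-dec ¬? (p i ≟ Y))
... | yes found = found
... | no none = ⊥-elim (<⇒notInjective 2<k which-injective)
  where
  target : Fin 2 → Fin m
  target 0F = X
  target 1F = Y
  covered : ∀ i → ∃ λ b → p i ≡ target b
  covered i with p i ≟ X | p i ≟ Y
  ... | yes pi≡X | _        = 0F , pi≡X
  ... | no  _    | yes pi≡Y = 1F , pi≡Y
  ... | no  pi≢X | no  pi≢Y = ⊥-elim (none (i , pi≢X , pi≢Y))
  which : Fin k → Fin 2
  which i = proj₁ (covered i)
  which-injective : Injective _≡_ _≡_ which
  which-injective {i} {j} eq =
    inj (trans (proj₂ (covered i)) (trans (cong target eq) (sym (proj₂ (covered j)))))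

iterate : {A : Set} → (A → A) → ℕ → A → A
iterate f zero    x = x
iterate f (suc k) x = f (iterate f k x)

iterate-+ : {A : Set} (f : A → A) (a b : ℕ) (x : A) →
  iterate f (a + b) x ≡ iterate f a (iterate f b x)
iterate-+ f zero    b x = refl
iterate-+ f (suc a) b x = cong f (iterate-+ f a b x)

iterate-injective : {A : Set} (f : A → A) → Injective _≡_ _≡_ f →
  ∀ k → Injective _≡_ _≡_ (iterate f k)
iterate-injective f inj zero    eq = eq
iterate-injective f inj (suc k) eq = iterate-injective f inj k (inj eq)

iterate-preserves : {A : Set} (R : A → A → Set) (f : A → A) →
  (∀ x y → R x y → R (f x) (f y)) → ∀ k x y → R x y → R (iterate f k x) (iterate f k y)
iterate-preserves R f pres zero    x y r = r
iterate-preserves R f pres (suc k) x y r = pres _ _ (iterate-preserves R f pres k x y r)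

-- An injective self-map of a finite set is periodic.  Among the n^n + 1 maps
-- f^0, …, f^(n^n) two agree, f^i = f^j with i < j, and cancelling f^i gives
-- f^(j-i) = id.
injective⇒periodic : ∀ {n} (f : Fin n → Fin n) → Injective _≡_ _≡_ f →
  ∃ λ d → ∀ x → iterate f (suc d) x ≡ x
injective⇒periodic {n} f inj
  with i , j , i<j , same-code ← pigeonhole (n<1+n (n ^ n)) (λ k → funToFin (iterate f (toℕ k)))
  with d , i+1+d≡j ← m≤n⇒∃[o]m+o≡n i<j
  = d , λ x → iterate-injective f inj (toℕ i) (begin
      iterate f (toℕ i) (iterate f (suc d) x)  ≡⟨ iterate-+ f (toℕ i) (suc d) x ⟨
      iterate f (toℕ i + suc d) x              ≡⟨ cong (λ k → iterate f k x) i+suc-d≡j ⟩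
      iterate f (toℕ j) x                      ≡⟨ finToFun-funToFin (iterate f (toℕ j)) x ⟨
      finToFun (funToFin (iterate f (toℕ j))) x ≡⟨ cong (λ c → finToFun c x) same-code ⟨
      finToFun (funToFin (iterate f (toℕ i))) x ≡⟨ finToFun-funToFin (iterate f (toℕ i)) x ⟩
      iterate f (toℕ i) x                      ∎)
  where
  open ≡-Reasoning
  i+suc-d≡j : toℕ i + suc d ≡ toℕ j
  i+suc-d≡j = trans (+-suc (toℕ i) d) i+1+d≡j

Twins : {A B : Set} → (A → B) → A → A → Set
Twins f P Q = P ≢ Q × f P ≡ f Q

-- An injective endomorphism is an automorphism: a suitable iterate f^d inverts it,
-- and f^d is again an endomorphism, so f reflects adjacency.
injective-endomorphism⇒automorphism : (S : IncidenceStructure) (f : Point S → Point S) →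
  IsEndomorphism S f → Injective _≡_ _≡_ f → IsAutomorphism S f
injective-endomorphism⇒automorphism S f endo inj = record
  { inverse       = iterate f d
  ; left-inverse  = left-inverse
  ; right-inverse = period
  ; preserves     = endo
  ; reflects      = λ P Q adj →
      subst₂ (Adj S) (left-inverse P) (left-inverse Q)
             (iterate-preserves (Adj S) f endo d (f P) (f Q) adj)
  }
  where
  d : ℕ
  d = proj₁ (injective⇒periodic f inj)
  period : ∀ P → f (iterate f d P) ≡ P
  period = proj₂ (injective⇒periodic f inj)
  left-inverse : ∀ P → iterate f d (f P) ≡ P
  left-inverse P = inj (period (f P))

proper-endomorphism-has-twins : (S : IncidenceStructure) (f : Point S → Point S) →
  IsProperEndomorphism S f → ∃₂ λ P Q → Twins f P Q
proper-endomorphism-has-twins S f (endo , not-automorphism)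
  with any? (λ P → any? (λ Q → ¬? (P ≟ Q) ×-dec (f P ≟ f Q)))
... | yes twins = twins
... | no no-twins =
  ⊥-elim (not-automorphism (injective-endomorphism⇒automorphism S f endo injective))
  where
  injective : Injective _≡_ _≡_ f
  injective {P} {Q} eq with P ≟ Q
  ... | yes P≡Q = P≡Q
  ... | no  P≢Q = ⊥-elim (no-twins (P , Q , P≢Q , eq))

collinear-images-distinct : (S : IncidenceStructure) (f : Point S → Point S) →
  IsEndomorphism S f → ∀ {P Q ℓ} → P ≢ Q →
  IncidenceStructure._I_ S P ℓ → IncidenceStructure._I_ S Q ℓ → f P ≢ f Q
collinear-images-distinct S f endo {P} {Q} {ℓ} P≢Q pℓ qℓ = proj₁ (endo P Q (P≢Q , ℓ , pℓ , qℓ))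

module Quadrangle {S : IncidenceStructure} {s t : ℕ} (gq : IsGQ S s t) where
  open IncidenceStructure S
  open IsPartialGeometry gq

  pointOn : Line S → Fin (suc s) → Point S
  pointOn ℓ i = proj₁ (Inverse.to (line-size ℓ) i)

  pointOn-incident : ∀ ℓ i → pointOn ℓ i I ℓ
  pointOn-incident ℓ i = proj₂ (Inverse.to (line-size ℓ) i)

  indexOn : ∀ {X ℓ} → X I ℓ → Fin (suc s)
  indexOn {X} {ℓ} xℓ = Inverse.from (line-size ℓ) (X , xℓ)

  pointOn-indexOn : ∀ {X ℓ} (xℓ : X I ℓ) → pointOn ℓ (indexOn xℓ) ≡ X
  pointOn-indexOn {X} {ℓ} xℓ = cong proj₁ (Inverse.strictlyInverseˡ (line-size ℓ) (X , xℓ))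

  lineThrough : Point S → Fin (suc t) → Line S
  lineThrough P i = proj₁ (Inverse.to (point-degree P) i)

  lineThrough-incident : ∀ P i → P I lineThrough P i
  lineThrough-incident P i = proj₂ (Inverse.to (point-degree P) i)

  incident? : ∀ X ℓ → Dec (X I ℓ)
  incident? X ℓ with any? (λ i → pointOn ℓ i ≟ X)
  ... | yes (i , eq) = yes (subst (_I ℓ) eq (pointOn-incident ℓ i))
  ... | no absent    = no λ xℓ → absent (indexOn xℓ , pointOn-indexOn xℓ)

  Transversal : Point S → Line S → Set
  Transversal P ℓ = Σ (Line S) λ m → P I m × ∃[ Q ] (Q I m × Q I ℓ)

  transversal : ∀ {P ℓ} → ¬ P I ℓ → Transversal P ℓ
  transversal {P} {ℓ} P∉ℓ = Inverse.to (alpha-axiom P ℓ P∉ℓ) 0F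

  transversal-unique : ∀ {P ℓ} → ¬ P I ℓ → (u v : Transversal P ℓ) → u ≡ v
  transversal-unique {P} {ℓ} P∉ℓ = unique-from-Fin1 (alpha-axiom P ℓ P∉ℓ)

  transversal-line : ∀ {P ℓ} → Transversal P ℓ → Σ (Line S) (P I_)
  transversal-line (m , pm , _) = m , pm

  transversal-foot : ∀ {P ℓ} → Transversal P ℓ → Σ (Point S) (_I ℓ)
  transversal-foot (_ , _ , Q , _ , qℓ) = Q , qℓ

  projection-unique : ∀ {Q ℓ A B m n} → ¬ Q I ℓ →
    Q I m → A I m → A I ℓ → Q I n → B I n → B I ℓ → A ≡ B
  projection-unique Q∉ℓ qm am aℓ qn bn bℓ =
    cong (proj₁ ∘ transversal-foot)
         (transversal-unique Q∉ℓ (_ , qm , _ , am , aℓ) (_ , qn , _ , bn , bℓ))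

  no-triangle : ∀ {A B C m n₁ n₂} → A ≢ B → A I m → B I m →
    A I n₁ → C I n₁ → B I n₂ → C I n₂ → C I m
  no-triangle {C = C} {m} A≢B am bm an₁ cn₁ bn₂ cn₂ with incident? C m
  ... | yes cm  = cm
  ... | no C∉m = ⊥-elim (A≢B (projection-unique C∉m cn₁ an₁ am cn₂ bn₂ bm))

  -- Incidence with a line missing some point Y is proof-irrelevant: two proofs of
  -- X I ℓ give two transversals, from Y to ℓ if X lies on the transversal line m of
  -- Y, and from X to m otherwise; uniqueness identifies the proofs.
  incidence-irrelevant : ∀ {X ℓ} → (∃ λ Y → ¬ Y I ℓ) → (p q : X I ℓ) → p ≡ q
  incidence-irrelevant {X} {ℓ} (Y , Y∉ℓ) p q with transversal Y∉ℓ
  ... | m , ym , Z , zm , zℓ with incident? X m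
  ... | yes xm = ,-injectiveʳ-UIP Fin-UIP (cong transversal-foot
          (transversal-unique Y∉ℓ (m , ym , X , xm , p) (m , ym , X , xm , q)))
  ... | no X∉m = ,-injectiveʳ-UIP Fin-UIP (cong transversal-line
          (transversal-unique X∉m (ℓ , p , Z , zℓ , zm) (ℓ , q , Z , zℓ , zm)))

  -- Twins of an endomorphism are not collinear, so every line misses one of them.
  twins-leave-points-off-lines : ∀ {f P Q} → IsEndomorphism S f → Twins f P Q →
    ∀ ℓ → ∃ λ Y → ¬ Y I ℓ
  twins-leave-points-off-lines {f} {P} {Q} endo (P≢Q , fP≡fQ) ℓ with incident? P ℓ
  ... | yes pℓ = Q , λ qℓ → collinear-images-distinct S f endo P≢Q pℓ qℓ fP≡fQ
  ... | no P∉ℓ = P , P∉ℓ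

  module Thick (off-line : ∀ ℓ → ∃ λ Y → ¬ Y I ℓ) (1<s : 1 < s) (1<t : 1 < t) where

    pointOn-injective : ∀ ℓ → Injective _≡_ _≡_ (pointOn ℓ)
    pointOn-injective ℓ {i} {j} eq =
      Injection.injective (↔⇒↣ (line-size ℓ))
        (pair-≡ eq (pointOn-incident ℓ i) (pointOn-incident ℓ j))
      where
      pair-≡ : ∀ {X X'} → X ≡ X' → (p : X I ℓ) (q : X' I ℓ) → (X , p) ≡ (X' , q)
      pair-≡ refl p q = cong (_ ,_) (incidence-irrelevant (off-line ℓ) p q)

    lineThrough-injective : ∀ P → Injective _≡_ _≡_ (lineThrough P)
    lineThrough-injective P {i} {j} eq =
      Injection.injective (↔⇒↣ (point-degree P))
        (pair-≡ eq (lineThrough-incident P i) (lineThrough-incident P j))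
      where
      pair-≡ : ∀ {ℓ ℓ'} → ℓ ≡ ℓ' → (p : P I ℓ) (q : P I ℓ') → (ℓ , p) ≡ (ℓ' , q)
      pair-≡ {ℓ} refl p q = cong (_ ,_) (incidence-irrelevant (off-line ℓ) p q)

    point-avoiding : ∀ ℓ X Y → ∃ λ Z → Z I ℓ × Z ≢ X × Z ≢ Y
    point-avoiding ℓ X Y
      with i , Z≢X , Z≢Y ← avoid-two (pointOn ℓ) (pointOn-injective ℓ) (s≤s 1<s) X Y
      = pointOn ℓ i , pointOn-incident ℓ i , Z≢X , Z≢Y

    line-avoiding : ∀ P ℓ → ∃ λ m → P I m × m ≢ ℓ
    line-avoiding P ℓ
      with i , m≢ℓ , _ ← avoid-two (lineThrough P) (lineThrough-injective P) (s≤s 1<t) ℓ ℓ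
      = lineThrough P i , lineThrough-incident P i , m≢ℓ

    distinct-points-on : ∀ ℓ → ∃₂ λ A B → A I ℓ × B I ℓ × A ≢ B
    distinct-points-on ℓ with B , bℓ , B≢A , _ ← point-avoiding ℓ (pointOn ℓ 0F) (pointOn ℓ 0F)
      = pointOn ℓ 0F , B , pointOn-incident ℓ 0F , bℓ , ≢-sym B≢A

    module Collapse (f : Point S → Point S) (endo : IsEndomorphism S f) where

      injective-on-line : ∀ {X Y ℓ} → X I ℓ → Y I ℓ → f X ≡ f Y → X ≡ Y
      injective-on-line xℓ yℓ fX≡fY with _ ≟ _
      ... | yes X≡Y = X≡Y
      ... | no  X≢Y = ⊥-elim (collinear-images-distinct S f endo X≢Y xℓ yℓ fX≡fY)

      MapsInto : Line S → Line S → Set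
      MapsInto ℓ L = ∀ X → X I ℓ → f X I L

      -- Two points of ℓ with distinct images on L force all of ℓ into L,
      -- since GQs have no triangles.
      maps-into-spanned : ∀ {ℓ L A B} → A I ℓ → B I ℓ → f A ≢ f B →
        f A I L → f B I L → MapsInto ℓ L
      maps-into-spanned {ℓ} {L} {A} {B} aℓ bℓ fA≢fB faL fbL X xℓ with X ≟ A | X ≟ B
      ... | yes refl | _        = faL
      ... | no _     | yes refl = fbL
      ... | no X≢A   | no X≢B
        with _ , n₁ , fan₁ , fxn₁ ← endo A X (≢-sym X≢A , ℓ , aℓ , xℓ)
           | _ , n₂ , fbn₂ , fxn₂ ← endo B X (≢-sym X≢B , ℓ , bℓ , xℓ)
        = no-triangle fA≢fB faL fbL fan₁ fxn₁ fbn₂ fxn₂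

      line-image : ∀ ℓ → ∃ (MapsInto ℓ)
      line-image ℓ
        with A , B , aℓ , bℓ , A≢B ← distinct-points-on ℓ
        with fA≢fB , L , faL , fbL ← endo A B (A≢B , ℓ , aℓ , bℓ)
        = L , maps-into-spanned aℓ bℓ fA≢fB faL fbL

      restriction : ∀ {ℓ L} → MapsInto ℓ L → Fin (suc s) → Fin (suc s)
      restriction {ℓ} ℓ↦L i = indexOn (ℓ↦L (pointOn ℓ i) (pointOn-incident ℓ i))

      restriction-point : ∀ {ℓ L} (ℓ↦L : MapsInto ℓ L) i →
        pointOn L (restriction ℓ↦L i) ≡ f (pointOn ℓ i)
      restriction-point {ℓ} ℓ↦L i = pointOn-indexOn (ℓ↦L (pointOn ℓ i) (pointOn-incident ℓ i))

      restriction-injective : ∀ {ℓ L} (ℓ↦L : MapsInto ℓ L) → Injective _≡_ _≡_ (restriction ℓ↦L)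
      restriction-injective {ℓ} {L} ℓ↦L {i} {j} eq = pointOn-injective ℓ (injective-on-line
        (pointOn-incident ℓ i) (pointOn-incident ℓ j)
        (trans (sym (restriction-point ℓ↦L i))
               (trans (cong (pointOn L) eq) (restriction-point ℓ↦L j))))

      -- f maps ℓ onto its image: both lines have s+1 points and f is injective on ℓ.
      line-image-onto : ∀ {ℓ L} → MapsInto ℓ L → ∀ Y → Y I L → ∃ λ X → X I ℓ × f X ≡ Y
      line-image-onto {ℓ} {L} ℓ↦L Y yL
        with i , hits-Y ← injective⇒surjective (restriction ℓ↦L) (restriction-injective ℓ↦L)
                                                (indexOn yL)
        = pointOn ℓ i , pointOn-incident ℓ i , (begin
            f (pointOn ℓ i)                 ≡⟨ restriction-point ℓ↦L i ⟨
            pointOn L (restriction ℓ↦L i)  ≡⟨ cong (pointOn L) hits-Y ⟩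
            pointOn L (indexOn yL)          ≡⟨ pointOn-indexOn yL ⟩
            Y                               ∎)
        where open ≡-Reasoning

      twins-not-collinear : ∀ {P Q ℓ} → Twins f P Q → P I ℓ → ¬ Q I ℓ
      twins-not-collinear (P≢Q , fP≡fQ) pℓ qℓ =
        collinear-images-distinct S f endo P≢Q pℓ qℓ fP≡fQ

      -- For twins P, Q, meeting lines ℓ ∋ P and m ∋ Q have the same image: both
      -- images contain f P = f Q and the image of the meeting point R ≢ P.
      twin-lines-meeting : ∀ {P Q R ℓ m L M} → Twins f P Q → P I ℓ → Q I m →
        R I ℓ → R I m → MapsInto ℓ L → MapsInto m M → L ≡ M
      twin-lines-meeting {P} {Q} {R} (P≢Q , fP≡fQ) pℓ qm rℓ rm ℓ↦L m↦M =
        points-join-once (f P) (f R) _ _ (ℓ↦L P pℓ) (ℓ↦L R rℓ)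
          (subst (_I _) (sym fP≡fQ) (m↦M Q qm)) (m↦M R rm)
          (collinear-images-distinct S f endo P≢R pℓ rℓ)
        where
        P≢R : P ≢ R
        P≢R P≡R = twins-not-collinear (P≢Q , fP≡fQ) (subst (_I _) (sym P≡R) rm) qm

      -- The foot B of A on m has f B adjacent to
      -- f A ∈ L and to f P = f Q ∈ M, so f B ∈ L (no triangles), while f B ≢ f P.
      twin-lines-via-point : ∀ {P Q A ℓ m L M} → Twins f P Q → P I ℓ → Q I m →
        A I ℓ → A ≢ P → (∀ {n} → Q I n → ¬ A I n) → MapsInto ℓ L → MapsInto m M → L ≡ M
      twin-lines-via-point {P} {Q} {A} {ℓ} {m} {L} {M} (P≢Q , fP≡fQ) pℓ qm aℓ A≢P A≁Q ℓ↦L m↦M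
        with transversal (A≁Q qm)
      ... | n , an , B , bn , bm
        with endo A B ((λ A≡B → A≁Q qm (subst (_I m) (sym A≡B) bm)) , n , an , bn)
      ... | _ , N , fA∈N , fB∈N =
        points-join-once (f P) (f B) L M (ℓ↦L P pℓ) fB∈L fP∈M (m↦M B bm) fP≢fB
        where
        fP∈M : f P I M
        fP∈M = subst (_I M) (sym fP≡fQ) (m↦M Q qm)
        B≢Q : B ≢ Q
        B≢Q B≡Q = A≁Q (subst (_I n) B≡Q bn) an
        fP≢fB : f P ≢ f B
        fP≢fB fP≡fB = collinear-images-distinct S f endo B≢Q bm qm (trans (sym fP≡fB) fP≡fQ)
        fB∈L : f B I L
        fB∈L = no-triangle (collinear-images-distinct S f endo (≢-sym A≢P) pℓ aℓ)
                 (ℓ↦L P pℓ) (ℓ↦L A aℓ) fP∈M (m↦M B bm) fA∈N fB∈N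

      -- For ℓ₁, ℓ₂ ∋ P,
      -- the transversal m₂ from Q to ℓ₂ has the image of ℓ₂ (they meet), and also that
      -- of ℓ₁, since ℓ₁ has a point A ≢ P other than the foot R₁ of Q on ℓ₁.
      twin-lines-same-image : ∀ {P Q ℓ₁ ℓ₂ L₁ L₂} → Twins f P Q → P I ℓ₁ → P I ℓ₂ →
        MapsInto ℓ₁ L₁ → MapsInto ℓ₂ L₂ → L₁ ≡ L₂
      twin-lines-same-image {P} {Q} {ℓ₁} {ℓ₂} twins pℓ₁ pℓ₂ ℓ₁↦L₁ ℓ₂↦L₂
        with transversal (twins-not-collinear twins pℓ₁)
           | transversal (twins-not-collinear twins pℓ₂)
      ... | m₁ , qm₁ , R₁ , r₁m₁ , r₁ℓ₁ | m₂ , qm₂ , R₂ , r₂m₂ , r₂ℓ₂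
        with point-avoiding ℓ₁ P R₁ | line-image m₂
      ... | A , aℓ₁ , A≢P , A≢R₁ | M₂ , m₂↦M₂ =
        trans (twin-lines-via-point twins pℓ₁ qm₂ aℓ₁ A≢P A≁Q ℓ₁↦L₁ m₂↦M₂)
              (sym (twin-lines-meeting twins pℓ₂ qm₂ r₂ℓ₂ r₂m₂ ℓ₂↦L₂ m₂↦M₂))
        where
        A≁Q : ∀ {n} → Q I n → ¬ A I n
        A≁Q qn an = A≢R₁ (projection-unique (twins-not-collinear twins pℓ₁)
                                             qn an aℓ₁ qm₁ r₁m₁ r₁ℓ₁)

      -- A point collinear with a point having a twin has a twin itself: f A lies on
      -- the common image of the lines through P, so some A' on a second line ℓ₂ ∋ P
      -- has f A' = f A.
      collinear-has-twin : ∀ {P Q A ℓ} → Twins f P Q → P I ℓ → A I ℓ → A ≢ P →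
        ∃ λ A' → Twins f A A'
      collinear-has-twin {P} {A = A} {ℓ} twins pℓ aℓ A≢P with line-avoiding P ℓ
      ... | ℓ₂ , pℓ₂ , ℓ₂≢ℓ with line-image ℓ | line-image ℓ₂
      ... | L , ℓ↦L | L₂ , ℓ₂↦L₂ = twin-from-preimage (line-image-onto ℓ₂↦L₂ (f A) fA∈L₂)
        where
        fA∈L₂ : f A I L₂
        fA∈L₂ = subst (f A I_) (twin-lines-same-image twins pℓ pℓ₂ ℓ↦L ℓ₂↦L₂) (ℓ↦L A aℓ)
        twin-from-preimage : (∃ λ A' → A' I ℓ₂ × f A' ≡ f A) → ∃ λ A' → Twins f A A'
        twin-from-preimage (A' , a'ℓ₂ , fA'≡fA) = A' , A≢A' , sym fA'≡fA
          where
          A≢A' : A ≢ A'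
          A≢A' A≡A' = ℓ₂≢ℓ (sym (points-join-once A P ℓ ℓ₂ aℓ pℓ
                                   (subst (_I ℓ₂) (sym A≡A') a'ℓ₂) pℓ₂ A≢P))

      module Collapsing {P₀ Q₀ : Point S} (twins : Twins f P₀ Q₀)
                        {ℓ₀ L : Line S} (pℓ₀ : P₀ I ℓ₀) (ℓ₀↦L : MapsInto ℓ₀ L) where

        lines-through-P₀ : ∀ {n N} → P₀ I n → MapsInto n N → N ≡ L
        lines-through-P₀ pn n↦N = sym (twin-lines-same-image twins pℓ₀ pn ℓ₀↦L n↦N)

        -- So do lines through a point A ≢ P₀ collinear with P₀, as A has a twin and
        -- shares the line ℓ with P₀.
        lines-through-neighbours : ∀ {A ℓ n N} → P₀ I ℓ → A I ℓ → A ≢ P₀ →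
          A I n → MapsInto n N → N ≡ L
        lines-through-neighbours {A} {ℓ} {n} {N} pℓ aℓ A≢P₀ an n↦N =
          via-twin (collinear-has-twin twins pℓ aℓ A≢P₀)
          where
          ℓ↦M : MapsInto ℓ (proj₁ (line-image ℓ))
          ℓ↦M = proj₂ (line-image ℓ)
          via-twin : (∃ λ A' → Twins f A A') → N ≡ L
          via-twin (_ , A-twins) =
            trans (sym (twin-lines-same-image A-twins aℓ an ℓ↦M n↦N)) (lines-through-P₀ pℓ ℓ↦M)

        -- A line n missing P₀ meets some line through P₀ in a point A ≢ P₀.
        every-line-image : ∀ {n N} → MapsInto n N → N ≡ L
        every-line-image {n} n↦N with incident? P₀ n
        ... | yes pn = lines-through-P₀ pn n↦N
        ... | no P₀∉n with ℓ , pℓ , A , aℓ , an ← transversal P₀∉n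
          = lines-through-neighbours pℓ aℓ (λ A≡P₀ → P₀∉n (subst (_I n) A≡P₀ an)) an n↦N

        image-on-L : ∀ X → f X I L
        image-on-L X with N , n↦N ← line-image (lineThrough X 0F)
          = subst (f X I_) (every-line-image n↦N) (n↦N X (lineThrough-incident X 0F))

        image-is-clique : ImageIsClique S f (suc s)
        image-is-clique = pointOn L , clique , covered , hit
          where
          clique : ∀ i j → i ≢ j → Adj S (pointOn L i) (pointOn L j)
          clique i j i≢j =
            i≢j ∘ pointOn-injective L , L , pointOn-incident L i , pointOn-incident L j
          covered : ∀ X → ∃ λ i → f X ≡ pointOn L i
          covered X = indexOn (image-on-L X) , sym (pointOn-indexOn (image-on-L X))
          hit : ∀ i → ∃ λ X → f X ≡ pointOn L i
          hit i with X , _ , fX≡ ← line-image-onto ℓ₀↦L (pointOn L i) (pointOn-incident L i)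
            = X , fX≡

-- A proper endomorphism has twins P₀, Q₀; they put a point off every line, so the
-- quadrangle is thick, and the image of any line through P₀ is the whole image of f.
mainTheorem2 : ∀ (S : IncidenceStructure) (s t : ℕ) → IsGQ S s t → 1 < s → 1 < t →
    ∀ (f : Point S → Point S) → IsProperEndomorphism S f →
    ImageIsClique S f (suc s)
mainTheorem2 S s t gq 1<s 1<t f proper@(endo , _)
  with P₀ , Q₀ , twins ← proper-endomorphism-has-twins S f proper
  = Collapsing.image-is-clique twins (lineThrough-incident P₀ 0F)
                               (proj₂ (line-image (lineThrough P₀ 0F)))
  where
  open Quadrangle gq
  open Thick (twins-leave-points-off-lines endo twins) 1<s 1<t
  open Collapse f endo
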